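{- Every finite $5$-directed Dean word $w$ satisfies $|w|<10$.
   Context: Words are over $\Sigma_4=\{0,1,2,3\}$; a word is reduced if it has no factor in $\{02,20,13,31\}$; a Dean word is a reduced word with no factor $uu$, $u$ nonempty. A word $u$ is $d$-directed if for every factor $f$ of $u$ of length $d$, the reversal $f^R$ of $f$ is not a factor of $u$. -}

module Defs where

open import Data.Fin using (Fin; zero; suc)
open import Data.List using (List; []; _∷_; _++_; length; reverse)
open import Data.Nat using (ℕ)
open import Data.Product using (∃; ∃-syntax; _×_)
open import Relation.Binary.PropositionalEquality using (_≡_)
open import Relation.Nullary using (¬_)

Letter : Set
Letter = Fin 4

Word : Set
Word = List Letter

Factor : Word → Word → Set
Factor f w = ∃[ p ] ∃[ s ] (w ≡ p ++ f ++ s)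

l0 l1 l2 l3 : Letter
l0 = zero
l1 = suc zero
l2 = suc (suc zero)
l3 = suc (suc (suc zero))

Reduced : Word → Set
Reduced w = ¬ Factor (l0 ∷ l2 ∷ []) w × ¬ Factor (l2 ∷ l0 ∷ []) w
          × ¬ Factor (l1 ∷ l3 ∷ []) w × ¬ Factor (l3 ∷ l1 ∷ []) w

SquareFree : Word → Set
SquareFree w = ∀ (u : Word) → ¬ (u ≡ []) → ¬ Factor (u ++ u) w

Dean : Word → Set
Dean w = Reduced w × SquareFree w

Directed : ℕ → Word → Set
Directed d w = ∀ (f : Word) → length f ≡ d → Factor f w → ¬ Factor (reverse f) w

-- Every property involved is inherited by prefixes, so it suffices to show that
-- no word of length 10 is a 5-directed Dean word.  This is a finite check: a
-- depth-first search over Σ₄ extends a word letter by letter and prunes a branch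
-- as soon as the current prefix contains a forbidden pair, a square or a length-5
-- factor together with its reversal; every branch dies by depth 10.
module Submission where

open import Defs
open import Data.Fin.Properties using (all?) renaming (_≟_ to _≟ᶠ_)
open import Data.List using (List; []; _∷_; _++_; _∷ʳ_; length; reverse; concatMap; inits; tails)
open import Data.List.Properties using (++-assoc; ≡-dec)
open import Data.List.Relation.Binary.Infix.Heterogeneous using (Infix; MkView; toView; fromView)
open import Data.List.Relation.Binary.Infix.Heterogeneous.Properties using (infix?)
open import Data.List.Relation.Binary.Pointwise using (Pointwise-≡⇒≡; ≡⇒Pointwise-≡)
open import Data.List.Relation.Unary.All using ([]; _∷_)
open import Data.List.Relation.Unary.All.Properties using (All¬⇒¬Any)
open import Data.List.Relation.Unary.Any using (Any; any?; satisfied)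
open import Data.Nat using (ℕ; zero; suc; _≤_; _<_; s≤s)
open import Data.Nat.Properties using (_≟_; ≰⇒>)
open import Data.Product using (_×_; _,_)
open import Data.Sum using (_⊎_; inj₁; inj₂)
open import Function using (_∘_)
open import Relation.Binary.PropositionalEquality using (_≡_; refl; sym; cong; subst; module ≡-Reasoning)
open import Relation.Nullary using (Dec; yes; no; ¬_; contradiction)
open import Relation.Nullary.Decidable using (map′; _×-dec_; _⊎-dec_; ¬?; toWitness)

infix⇒factor : ∀ {f w} → Infix _≡_ f w → Factor f w
infix⇒factor i with MkView p f≡inf s ← toView i =
  p , s , cong (λ inf → p ++ inf ++ s) (sym (Pointwise-≡⇒≡ f≡inf))

factor⇒infix : ∀ {f w} → Factor f w → Infix _≡_ f w
factor⇒infix (p , s , refl) = fromView (MkView p (≡⇒Pointwise-≡ refl) s)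

factor? : (f w : Word) → Dec (Factor f w)
factor? f w = map′ infix⇒factor factor⇒infix (infix? _≟ᶠ_ f w)

factor-++ʳ : ∀ {f p} s → Factor f p → Factor f (p ++ s)
factor-++ʳ {f} s (x , y , refl) = x , y ++ s , eq
  where
  open ≡-Reasoning
  eq : (x ++ f ++ y) ++ s ≡ x ++ f ++ y ++ s
  eq = begin
    (x ++ f ++ y) ++ s ≡⟨ ++-assoc x (f ++ y) s ⟩
    x ++ (f ++ y) ++ s ≡⟨ cong (x ++_) (++-assoc f y s) ⟩
    x ++ f ++ y ++ s   ∎

reduced-++ʳ : ∀ {p} s → Reduced (p ++ s) → Reduced p
reduced-++ʳ s (¬02 , ¬20 , ¬13 , ¬31) =
  ¬02 ∘ factor-++ʳ s , ¬20 ∘ factor-++ʳ s , ¬13 ∘ factor-++ʳ s , ¬31 ∘ factor-++ʳ s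

squareFree-++ʳ : ∀ {p} s → SquareFree (p ++ s) → SquareFree p
squareFree-++ʳ s sf u u≢[] = sf u u≢[] ∘ factor-++ʳ s

directed-++ʳ : ∀ {d p} s → Directed d (p ++ s) → Directed d p
directed-++ʳ s dir f |f|≡d f⊑p = dir f |f|≡d (factor-++ʳ s f⊑p) ∘ factor-++ʳ s

DirectedDean : ℕ → Word → Set
DirectedDean d w = Dean w × Directed d w

directedDean-++ʳ : ∀ {d p} s → DirectedDean d (p ++ s) → DirectedDean d p
directedDean-++ʳ s ((red , sf) , dir) =
  (reduced-++ʳ s red , squareFree-++ʳ s sf) , directed-++ʳ s dir

forbiddenPairs : List Word
forbiddenPairs = (l0 ∷ l2 ∷ []) ∷ (l2 ∷ l0 ∷ []) ∷ (l1 ∷ l3 ∷ []) ∷ (l3 ∷ l1 ∷ []) ∷ []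

infixes : Word → List Word
infixes p = concatMap inits (tails p)

-- The candidate lists only bound the search; each witness carries its own factor proofs.
Refuted : ℕ → Word → Set
Refuted d p = Any (λ f → Factor f p) forbiddenPairs
            ⊎ Any (λ u → ¬ u ≡ [] × Factor (u ++ u) p) (infixes p)
            ⊎ Any (λ f → length f ≡ d × Factor f p × Factor (reverse f) p) (infixes p)

refuted? : ∀ d p → Dec (Refuted d p)
refuted? d p =
  any? (λ f → factor? f p) forbiddenPairs
  ⊎-dec any? (λ u → ¬? (≡-dec _≟ᶠ_ u []) ×-dec factor? (u ++ u) p) (infixes p)
  ⊎-dec any? (λ f → (length f ≟ d) ×-dec factor? f p ×-dec factor? (reverse f) p) (infixes p)

refuted⇒¬directedDean : ∀ {d p} → Refuted d p → ¬ DirectedDean d p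
refuted⇒¬directedDean (inj₁ pair) (((¬02 , ¬20 , ¬13 , ¬31) , _) , _) =
  All¬⇒¬Any (¬02 ∷ ¬20 ∷ ¬13 ∷ ¬31 ∷ []) pair
refuted⇒¬directedDean (inj₂ (inj₁ square)) ((_ , sf) , _)
  with u , u≢[] , uu⊑p ← satisfied square = sf u u≢[] uu⊑p
refuted⇒¬directedDean (inj₂ (inj₂ reversible)) (_ , dir)
  with f , |f|≡d , f⊑p , fᴿ⊑p ← satisfied reversible = dir f |f|≡d f⊑p fᴿ⊑p

data Doomed (d : ℕ) : ℕ → Word → Set where
  refuted : ∀ {n p} → Refuted d p → Doomed d n p
  branch  : ∀ {n p} → (∀ a → Doomed d n (p ∷ʳ a)) → Doomed d (suc n) p

doomed? : ∀ d n p → Dec (Doomed d n p)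
doomed? d n p with refuted? d p
... | yes r = yes (refuted r)
doomed? d zero p | no ¬r = no λ { (refuted r) → ¬r r }
doomed? d (suc n) p | no ¬r = map′ branch children (all? λ a → doomed? d n (p ∷ʳ a))
  where
  children : Doomed d (suc n) p → ∀ a → Doomed d n (p ∷ʳ a)
  children (refuted r) = contradiction r ¬r
  children (branch ds) = ds

doomed⇒¬directedDean : ∀ {d n p} → Doomed d n p → ∀ s → n ≤ length s → ¬ DirectedDean d (p ++ s)
doomed⇒¬directedDean (refuted r) s _ = refuted⇒¬directedDean r ∘ directedDean-++ʳ s
doomed⇒¬directedDean {d} {p = p} (branch ds) (a ∷ s) (s≤s n≤|s|) =
  doomed⇒¬directedDean (ds a) s n≤|s| ∘ subst (DirectedDean d) (sym (++-assoc p (a ∷ []) s))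

mainTheorem20 : (w : Word) → Dean w → Directed 5 w → length w < 10
mainTheorem20 w dean dir = ≰⇒> λ 10≤|w| →
  doomed⇒¬directedDean (toWitness {a? = doomed? 5 10 []} _) w 10≤|w| (dean , dir)
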